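{- Let $G$ be a simple connected graph of order $n=|V(G)|\geq 3$. Then $$\lambda(G)\leq \partial(R(G))\leq \lambda(G)+\left\lfloor\frac{|V(G)|-\mu(G)}{2}\right\rfloor,$$ where $\lambda(G)=|E(G)|-|V(G)|+2\alpha(G)$ and $\mu(G)$ is the maximum cardinality of a differential set of $R(G)$ contained in $V(G)$.
   Context: $R(G)$ is the graph obtained from $G$ by adding, for each edge $e=xy\in E(G)$, a new vertex $v_e$ adjacent exactly to $x$ and $y$; thus $V(G)\subseteq V(R(G))$. For a graph $H$ and $S\subseteq V(H)$, $N_H(S)$ is the set of vertices adjacent to some vertex of $S$, $B_H(S)=N_H(S)\setminus S$, and the differential of $S$ is $\partial_H(S)=|B_H(S)|-|S|$. The differential of $H$ is $\partial(H)=\max\{\partial_H(S): S\subseteq V(H)\}$, and $S$ is a differential set of $H$ if $\partial_H(S)=\partial(H)$. $\alpha(G)$ is the independence number of $G$. -}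

module Defs where

open import Data.Nat as ℕ using (ℕ; zero; suc; _<_)
open import Data.Integer as ℤ using (ℤ; +_; _-_)
open import Data.Bool using (Bool; true; false; _∧_; _∨_; not; T)
open import Data.Fin using (Fin; zero; suc; _<?_; splitAt; _↑ˡ_; _↑ʳ_)
open import Data.Fin.Subset using (Subset; ∣_∣; _∈_; inside; outside)
open import Data.Vec using (Vec; []; _∷_; lookup; tabulate)
open import Data.List using (List; []; _∷_; map; _++_; length; filter; allFin; concatMap; foldr)
open import Data.Bool.ListAction using (any)
import Data.List as List
open import Data.Product using (Σ; _×_; _,_; proj₁; proj₂; ∃)
open import Data.Sum using (_⊎_; inj₁; inj₂)
open import Relation.Binary.PropositionalEquality using (_≡_)
open import Relation.Nullary.Decidable using (⌊_⌋)

record Graph : Set where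
  field
    order   : ℕ
    adj     : Fin order → Fin order → Bool
    adj-sym : ∀ i j → adj i j ≡ adj j i
    adj-irr : ∀ i → adj i i ≡ false
open Graph public

data Reach (G : Graph) : Fin (order G) → Fin (order G) → Set where
  here : ∀ {i} → Reach G i i
  step : ∀ {i j k} → T (adj G i j) → Reach G j k → Reach G i k

Connected : Graph → Set
Connected G = ∀ i j → Reach G i j

edges : (G : Graph) → List (Fin (order G) × Fin (order G))
edges G = filter (λ p → Data.Bool.T? (⌊ proj₁ p <? proj₂ p ⌋ ∧ adj G (proj₁ p) (proj₂ p)))
                 (concatMap (λ i → map (λ j → (i , j)) (allFin _)) (allFin _))
  where import Data.Bool

size : Graph → ℕ
size G = length (edges G)

-- The graph R(G): vertices Fin (n + m), the first n being V(G) (via ↑ˡ),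
-- the last m being the new vertices v_e (via ↑ʳ), e ranging over edges G.

private
  eqb : ∀ {n} → Fin n → Fin n → Bool
  eqb i j = ⌊ i Data.Fin.≟ j ⌋
    where import Data.Fin

  endpoint : (G : Graph) → Fin (order G) → Fin (size G) → Bool
  endpoint G x e = let p = List.lookup (edges G) e in
                   eqb x (proj₁ p) ∨ eqb x (proj₂ p)

  adjR : (G : Graph) → Fin (order G ℕ.+ size G) → Fin (order G ℕ.+ size G) → Bool
  adjR G u v with splitAt (order G) u | splitAt (order G) v
  ... | inj₁ x | inj₁ y = adj G x y
  ... | inj₁ x | inj₂ e = endpoint G x e
  ... | inj₂ e | inj₁ y = endpoint G y e
  ... | inj₂ _ | inj₂ _ = false

-- the adjacency relation of R(G) (symmetry/irreflexivity are evident by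
-- construction; R(G) is given as a "raw graph": order and adjacency)
record RawGraph : Set where
  field
    rorder : ℕ
    radj   : Fin rorder → Fin rorder → Bool
open RawGraph public

toRaw : Graph → RawGraph
toRaw G = record { rorder = order G ; radj = adj G }

R : Graph → RawGraph
R G = record { rorder = order G ℕ.+ size G ; radj = adjR G }

allSubsets : (n : ℕ) → List (Subset n)
allSubsets zero    = [] ∷ []
allSubsets (suc n) = map (inside ∷_) (allSubsets n) ++ map (outside ∷_) (allSubsets n)

memb : ∀ {n} → Fin n → Subset n → Bool
memb i S with lookup S i
... | inside  = true
... | outside = false

N : (H : RawGraph) → Subset (rorder H) → Subset (rorder H)
N H S = tabulate (λ v → if any (λ u → memb u S ∧ radj H u v) (allFin _) then inside else outside)
  where open import Data.Bool using (if_then_else_)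

B : (H : RawGraph) → Subset (rorder H) → Subset (rorder H)
B H S = tabulate (λ v → if memb v (N H S) ∧ not (memb v S) then inside else outside)
  where open import Data.Bool using (if_then_else_)

∂S : (H : RawGraph) → Subset (rorder H) → ℤ
∂S H S = + ∣ B H S ∣ - + ∣ S ∣

maxℤ : List ℤ → ℤ
maxℤ = foldr ℤ._⊔_ (+ 0)

maxℕ : List ℕ → ℕ
maxℕ = foldr ℕ._⊔_ 0

-- ∂(H) = max over all S ⊆ V(H) of ∂_H(S)   (∂_H(∅) = 0, so seeding the max with 0 is harmless)
∂ : RawGraph → ℤ
∂ H = maxℤ (map (∂S H) (allSubsets (rorder H)))

IsDifferentialSet : (H : RawGraph) → Subset (rorder H) → Set
IsDifferentialSet H S = ∂S H S ≡ ∂ H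

Independent : (G : Graph) → Subset (order G) → Bool
Independent G S = not (any (λ u → any (λ v → memb u S ∧ memb v S ∧ adj G u v) (allFin _)) (allFin _))

α : Graph → ℕ
α G = maxℕ (map ∣_∣ (filter (λ S → Data.Bool.T? (Independent G S)) (allSubsets (order G))))
  where import Data.Bool

λG : Graph → ℤ
λG G = + size G - + order G ℤ.+ + (2 ℕ.* α G)

InV : (G : Graph) → Subset (order G ℕ.+ size G) → Bool
InV G S = not (any (λ e → memb (order G ↑ʳ e) S) (allFin (size G)))

μ : Graph → ℕ
μ G = maxℕ (map ∣_∣ (filter (λ S → Data.Bool.T? (InV G S ∧ ⌊ ∂S (R G) S ℤ.≟ ∂ (R G) ⌋))
                            (allSubsets (order G ℕ.+ size G))))
  where import Data.Bool

-- Write a set of vertices of R(G) as A ∪ {v_e : e ∈ F} with A ⊆ V(G). Replacing every v_e by an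
-- end of e never decreases the differential, so ∂(R(G)) is attained by some A ⊆ V(G), and by one
-- with μ(G) ≤ |A|. For T = V(G) ∖ A the boundary of A consists of vertices of T and of the v_e with
-- an end in A, hence ∂(A) ≤ |T| + (m − e(T)) − |A|, where e(T) is the number of edges of G[T].
-- Deleting vertices of degree at least 2 from G[T] until it is a matching plus isolated vertices
-- gives 2|T| ≤ 2α(G) + e(T) + ⌊|T|/2⌋, and |T| ≤ n − μ(G) gives the upper bound. For the lower
-- bound take A = V(G) ∖ I for a maximum independent set I: as G has no isolated vertex, every
-- vertex of I and every v_e lies in the boundary of A.

module Submission where

open import Defs

open import Data.Bool using (Bool; true; false; T; T?; not; _∧_; _∨_; if_then_else_)
open import Data.Bool.ListAction using (any)
open import Data.Bool.Properties using (T-∧; T-∨; T-≡; ∧-zeroʳ; ∧-identityʳ)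
open import Data.Empty using (⊥; ⊥-elim)
open import Data.Fin as Fin using (Fin; zero; suc; _↑ˡ_; _↑ʳ_)
open import Data.Fin.Properties as Finₚ
  using (punchInᵢ≢i; any?; splitAt-↑ˡ; splitAt-↑ʳ; splitAt⁻¹-↑ˡ; splitAt⁻¹-↑ʳ)
open import Data.Fin.Subset using (Subset; ∣_∣; inside; outside) renaming (⊥ to ∅)
open import Data.Fin.Subset.Properties using (∣⊥∣≡0)
open import Data.Integer as ℤ using (_⊖_) renaming (_≤_ to _≤ℤ_)
import Data.Integer.Properties as ℤ
open import Data.List as List using (List; allFin)
open import Data.List.Membership.Propositional using (_∈_; lose)
open import Data.List.Membership.Propositional.Properties
  using (∈-allFin; ∈-map⁺; ∈-map⁻; ∈-filter⁺; ∈-filter⁻; ∈-lookup; ∈-++⁺ˡ; ∈-++⁺ʳ; foldr-selective)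
open import Data.List.Properties using (foldr-forcesᵇ; map-tabulate; map-++; map-cong; map-∘)
open import Data.List.Relation.Unary.All as All using ()
open import Data.List.Relation.Unary.Any using (here; satisfied)
open import Data.List.Relation.Unary.Any.Properties using (any⁺; any⁻)
open import Data.Nat hiding (_<ᵇ_)
open import Data.Nat.DivMod using (_/_; m*n/n≡m; /-monoˡ-≤)
open import Data.Nat.ListAction using () renaming (sum to sumᴸ)
open import Data.Nat.ListAction.Properties using (sum-++)
open import Data.Nat.Properties hiding (<⇒<ᵇ; <ᵇ⇒<)
open import Data.Nat.Tactic.RingSolver using (solve-∀)
open import Data.Product using (∃; _×_; _,_; proj₁; proj₂; uncurry)
open import Data.Sum using (_⊎_; inj₁; inj₂; [_,_]; [_,_]′)
open import Data.Vec using ([]; _∷_; lookup; tabulate)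
open import Data.Vec.Properties using (lookup∘tabulate; lookup-replicate)
open import Function using (_∘_; Equivalence; const; id)
open import Relation.Binary.Definitions using (Tri; tri<; tri≈; tri>)
open import Relation.Binary.PropositionalEquality hiding ([_])
open import Relation.Nullary using (¬_; Dec; _×-dec_)
open import Relation.Nullary.Decidable using (⌊_⌋; toWitness; fromWitness; yes; no)

open import Algebra.Properties.CommutativeMonoid.Sum +-0-commutativeMonoid
  using (sum; sum-syntax; sum-cong-≗; sum-replicate-zero; sum-remove; ∑-distrib-+; ∑-comm)
open import Algebra.Properties.Semiring.Sum +-*-semiring using (*-distribˡ-sum)

T-not⁻ : ∀ {b} → T (not b) → ¬ T b
T-not⁻ {false} _ ()

T-not⁺ : ∀ {b} → ¬ T b → T (not b)
T-not⁺ {false} _  = _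
T-not⁺ {true}  ¬b = ¬b _

𝟙 : Bool → ℕ
𝟙 true  = 1
𝟙 false = 0

𝟙-mono : ∀ {a b} → (T a → T b) → 𝟙 a ≤ 𝟙 b
𝟙-mono {false}         _ = z≤n
𝟙-mono {true} {true}   _ = ≤-refl
𝟙-mono {true} {false} ab = ⊥-elim (ab _)

𝟙-≤-+ : ∀ {a b c} → (T a → T b ⊎ T c) → 𝟙 a ≤ 𝟙 b + 𝟙 c
𝟙-≤-+ {false} _ = z≤n
𝟙-≤-+ {true} {b} {c} a⇒b⊎c with a⇒b⊎c _
... | inj₁ tb = ≤-trans (𝟙-mono {true} {b} λ _ → tb) (m≤m+n (𝟙 b) (𝟙 c))
... | inj₂ tc = ≤-trans (𝟙-mono {true} {c} λ _ → tc) (m≤n+m (𝟙 c) (𝟙 b))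

𝟙-+-≤ : ∀ {a b c} → (T a → T b → ⊥) → (T a → T c) → (T b → T c) → 𝟙 a + 𝟙 b ≤ 𝟙 c
𝟙-+-≤ {false}         _ _  b⇒c = 𝟙-mono b⇒c
𝟙-+-≤ {true} {false}  _ a⇒c _   = 𝟙-mono a⇒c
𝟙-+-≤ {true} {true}  a#b _ _    = ⊥-elim (a#b _ _)

𝟙-true : ∀ {a} → T a → 𝟙 a ≡ 1
𝟙-true {true} _ = refl

𝟙-false : ∀ {a} → ¬ T a → 𝟙 a ≡ 0
𝟙-false {false} _  = refl
𝟙-false {true}  ¬a = ⊥-elim (¬a _)

-- This is definitionally the equality test used in Defs.R, which radj-ve and radj-ev rely on.
_==_ : ∀ {k} → Fin k → Fin k → Bool
i == j = ⌊ i Fin.≟ j ⌋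

==-refl : ∀ {k} (i : Fin k) → T (i == i)
==-refl i = fromWitness refl

==⇒≡ : ∀ {k} {i j : Fin k} → T (i == j) → i ≡ j
==⇒≡ = toWitness

_<ᵇ_ : ∀ {k} → Fin k → Fin k → Bool
i <ᵇ j = ⌊ i Fin.<? j ⌋

<⇒<ᵇ : ∀ {k} {i j : Fin k} → i Fin.< j → T (i <ᵇ j)
<⇒<ᵇ = fromWitness

<ᵇ⇒< : ∀ {k} {i j : Fin k} → T (i <ᵇ j) → i Fin.< j
<ᵇ⇒< = toWitness

∃-≢ : ∀ {k} → 2 ≤ k → (x : Fin k) → ∃ λ y → x ≢ y
∃-≢ {suc (suc k)} _ zero    = suc zero , λ ()
∃-≢ {suc (suc k)} _ (suc x) = zero , λ ()
∃-≢ {suc zero}    (s≤s ()) zero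

count : ∀ {k} → (Fin k → Bool) → ℕ
count {k} p = ∑[ i < k ] 𝟙 (p i)

∑-mono-≤ : ∀ {k} {f g : Fin k → ℕ} → (∀ i → f i ≤ g i) → sum f ≤ sum g
∑-mono-≤ {zero}  f≤g = z≤n
∑-mono-≤ {suc k} f≤g = +-mono-≤ (f≤g zero) (∑-mono-≤ (f≤g ∘ suc))

∑-↑ : ∀ n {m} (f : Fin (n + m) → ℕ) →
      sum f ≡ ∑[ i < n ] f (i ↑ˡ m) + ∑[ j < m ] f (n ↑ʳ j)
∑-↑ zero    f = refl
∑-↑ (suc n) f = trans (cong (f zero +_) (∑-↑ n (f ∘ suc))) (sym (+-assoc (f zero) _ _))

term≤∑ : ∀ {k} (f : Fin k → ℕ) i → f i ≤ sum f
term≤∑ {suc k} f i = ≤-trans (m≤m+n (f i) _) (≤-reflexive (sym (sum-remove {i = i} f)))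

∑-single : ∀ {k} (f : Fin k → ℕ) v → (∀ j → j ≢ v → f j ≡ 0) → sum f ≡ f v
∑-single {suc k} f v off-v = begin
  sum f                                 ≡⟨ sum-remove {i = v} f ⟩
  f v + ∑[ j < k ] f (Fin.punchIn v j)  ≡⟨ cong (f v +_) (sum-cong-≗ (λ j → off-v _ (punchInᵢ≢i v j))) ⟩
  f v + ∑[ j < k ] 0                    ≡⟨ cong (f v +_) (sum-replicate-zero k) ⟩
  f v + 0                               ≡⟨ +-identityʳ (f v) ⟩
  f v                                   ∎
  where open ≡-Reasoning

count-== : ∀ {k} (v : Fin k) → count (_== v) ≡ 1
count-== v = trans (∑-single (λ j → 𝟙 (j == v)) v (λ j j≢v → 𝟙-false (j≢v ∘ ==⇒≡)))
                   (𝟙-true (==-refl v))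

∑-== : ∀ {k} (h : Fin k → ℕ) v → ∑[ i < k ] (𝟙 (i == v) * h i) ≡ h v
∑-== h v = begin
  ∑[ i < _ ] (𝟙 (i == v) * h i) ≡⟨ ∑-single (λ i → 𝟙 (i == v) * h i) v
                                      (λ i i≢v → cong (_* h i) (𝟙-false (i≢v ∘ ==⇒≡))) ⟩
  𝟙 (v == v) * h v              ≡⟨ cong (_* h v) (𝟙-true (==-refl v)) ⟩
  1 * h v                       ≡⟨ *-identityˡ (h v) ⟩
  h v                           ∎
  where open ≡-Reasoning

∑∑-distrib-+ : ∀ {k l} (f g : Fin k → Fin l → ℕ) →
  ∑[ i < k ] ∑[ j < l ] (f i j + g i j) ≡ ∑[ i < k ] ∑[ j < l ] f i j + ∑[ i < k ] ∑[ j < l ] g i j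
∑∑-distrib-+ f g = trans (sum-cong-≗ λ i → ∑-distrib-+ (f i) (g i)) (∑-distrib-+ (sum ∘ f) (sum ∘ g))

count-true : ∀ k → count {k} (const true) ≡ k
count-true zero    = refl
count-true (suc k) = cong suc (count-true k)

count+count-not : ∀ {k} (p : Fin k → Bool) → count p + count (not ∘ p) ≡ k
count+count-not {k} p = begin
  count p + count (not ∘ p)          ≡⟨ ∑-distrib-+ (𝟙 ∘ p) (𝟙 ∘ not ∘ p) ⟨
  ∑[ i < k ] (𝟙 (p i) + 𝟙 (not (p i))) ≡⟨ sum-cong-≗ (λ i → 𝟙+𝟙-not (p i)) ⟩
  count {k} (const true)             ≡⟨ count-true k ⟩
  k                                  ∎
  where
  open ≡-Reasoning
  𝟙+𝟙-not : ∀ b → 𝟙 b + 𝟙 (not b) ≡ 1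
  𝟙+𝟙-not true  = refl
  𝟙+𝟙-not false = refl

_∖_ : ∀ {k} → (Fin k → Bool) → Fin k → Fin k → Bool
(P ∖ v) i = P i ∧ not (i == v)

count-∖ : ∀ {k} (P : Fin k → Bool) {v} → T (P v) → count P ≡ suc (count (P ∖ v))
count-∖ P {v} Pv = begin
  count P                                ≡⟨ sum-cong-≗ split ⟩
  ∑[ i < _ ] (𝟙 ((P ∖ v) i) + 𝟙 (i == v)) ≡⟨ ∑-distrib-+ (𝟙 ∘ (P ∖ v)) (𝟙 ∘ (_== v)) ⟩
  count (P ∖ v) + count (_== v)          ≡⟨ cong (count (P ∖ v) +_) (count-== v) ⟩
  count (P ∖ v) + 1                      ≡⟨ +-comm (count (P ∖ v)) 1 ⟩
  suc (count (P ∖ v))                    ∎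
  where
  open ≡-Reasoning
  split : ∀ i → 𝟙 (P i) ≡ 𝟙 (P i ∧ not (i == v)) + 𝟙 (i == v)
  split i with i Fin.≟ v
  ... | yes refl rewrite Equivalence.to T-≡ Pv = refl
  ... | no _     rewrite ∧-identityʳ (P i) = sym (+-identityʳ (𝟙 (P i)))

∑∑-split-< : ∀ {k} (f : Fin k → Fin k → ℕ) → (∀ i → f i i ≡ 0) →
  ∑[ i < k ] ∑[ j < k ] f i j ≡
  ∑[ i < k ] ∑[ j < k ] (𝟙 (i <ᵇ j) * f i j) + ∑[ i < k ] ∑[ j < k ] (𝟙 (j <ᵇ i) * f i j)
∑∑-split-< {k} f f-irrefl = begin
  ∑[ i < k ] ∑[ j < k ] f i j
    ≡⟨ sum-cong-≗ (λ i → trans (sum-cong-≗ (split i)) (∑-distrib-+ (lower i) (upper i))) ⟩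
  ∑[ i < k ] (∑[ j < k ] (𝟙 (i <ᵇ j) * f i j) + ∑[ j < k ] (𝟙 (j <ᵇ i) * f i j))
    ≡⟨ ∑-distrib-+ (sum ∘ lower) (sum ∘ upper) ⟩
  ∑[ i < k ] ∑[ j < k ] (𝟙 (i <ᵇ j) * f i j) + ∑[ i < k ] ∑[ j < k ] (𝟙 (j <ᵇ i) * f i j) ∎
  where
  open ≡-Reasoning
  lower upper : Fin k → Fin k → ℕ
  lower i j = 𝟙 (i <ᵇ j) * f i j
  upper i j = 𝟙 (j <ᵇ i) * f i j
  x≡1*x+0*x : ∀ x → x ≡ 1 * x + 0 * x
  x≡1*x+0*x = solve-∀
  x≡0*x+1*x : ∀ x → x ≡ 0 * x + 1 * x
  x≡0*x+1*x = solve-∀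
  split : ∀ i j → f i j ≡ 𝟙 (i <ᵇ j) * f i j + 𝟙 (j <ᵇ i) * f i j
  split i j with Finₚ.<-cmp i j
  ... | tri< i<j _ j≮i = begin
    f i j                 ≡⟨ x≡1*x+0*x (f i j) ⟩
    1 * f i j + 0 * f i j ≡⟨ cong₂ (λ a b → a * f i j + b * f i j)
                                   (𝟙-true (<⇒<ᵇ i<j)) (𝟙-false (j≮i ∘ <ᵇ⇒<)) ⟨
    _                     ∎
  ... | tri> i≮j _ j<i = begin
    f i j                 ≡⟨ x≡0*x+1*x (f i j) ⟩
    0 * f i j + 1 * f i j ≡⟨ cong₂ (λ a b → a * f i j + b * f i j)
                                   (𝟙-false (i≮j ∘ <ᵇ⇒<)) (𝟙-true (<⇒<ᵇ j<i)) ⟨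
    _                     ∎
  ... | tri≈ _ refl _ rewrite f-irrefl i | *-zeroʳ (𝟙 (i <ᵇ i)) = refl

∑∑-swap-< : ∀ {k} (f : Fin k → Fin k → ℕ) → (∀ i j → f i j ≡ f j i) →
  ∑[ i < k ] ∑[ j < k ] (𝟙 (j <ᵇ i) * f i j) ≡ ∑[ i < k ] ∑[ j < k ] (𝟙 (i <ᵇ j) * f i j)
∑∑-swap-< f f-sym = trans (∑-comm (λ i j → 𝟙 (j <ᵇ i) * f i j))
  (sum-cong-≗ λ j → sum-cong-≗ λ i → cong (𝟙 (j <ᵇ i) *_) (f-sym i j))

sumᴸ-tabulate : ∀ {k} (h : Fin k → ℕ) → sumᴸ (List.tabulate h) ≡ sum h
sumᴸ-tabulate {zero}  h = refl
sumᴸ-tabulate {suc k} h = cong (h zero +_) (sumᴸ-tabulate (h ∘ suc))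

sumᴸ-map-allFin : ∀ {k} (h : Fin k → ℕ) → sumᴸ (List.map h (allFin k)) ≡ sum h
sumᴸ-map-allFin h = trans (cong sumᴸ (map-tabulate id h)) (sumᴸ-tabulate h)

module _ {A : Set} where

  ∑-lookup : ∀ (xs : List A) (h : A → ℕ) →
             ∑[ e < List.length xs ] h (List.lookup xs e) ≡ sumᴸ (List.map h xs)
  ∑-lookup List.[]       h = refl
  ∑-lookup (x List.∷ xs) h = cong (h x +_) (∑-lookup xs h)

  sumᴸ-map-filter : ∀ (b : A → Bool) (h : A → ℕ) xs →
    sumᴸ (List.map h (List.filter (T? ∘ b) xs)) ≡ sumᴸ (List.map (λ x → 𝟙 (b x) * h x) xs)
  sumᴸ-map-filter b h List.[] = refl
  sumᴸ-map-filter b h (x List.∷ xs) with b x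
  ... | true  = cong₂ _+_ (sym (+-identityʳ (h x))) (sumᴸ-map-filter b h xs)
  ... | false = sumᴸ-map-filter b h xs

  sumᴸ-map-concatMap : ∀ {B : Set} (f : A → List B) (h : B → ℕ) xs →
    sumᴸ (List.map h (List.concatMap f xs)) ≡ sumᴸ (List.map (sumᴸ ∘ List.map h ∘ f) xs)
  sumᴸ-map-concatMap f h List.[] = refl
  sumᴸ-map-concatMap f h (x List.∷ xs) = begin
    sumᴸ (List.map h (f x List.++ List.concatMap f xs))
      ≡⟨ cong sumᴸ (map-++ h (f x) _) ⟩
    sumᴸ (List.map h (f x) List.++ List.map h (List.concatMap f xs))
      ≡⟨ sum-++ (List.map h (f x)) _ ⟩
    sumᴸ (List.map h (f x)) + sumᴸ (List.map h (List.concatMap f xs))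
      ≡⟨ cong (sumᴸ (List.map h (f x)) +_) (sumᴸ-map-concatMap f h xs) ⟩
    sumᴸ (List.map h (f x)) + sumᴸ (List.map (sumᴸ ∘ List.map h ∘ f) xs) ∎
    where open ≡-Reasoning

any-allFin⁺ : ∀ {k} (p : Fin k → Bool) i → T (p i) → T (any p (allFin k))
any-allFin⁺ p i pi = any⁺ p (lose (∈-allFin i) pi)

any-allFin⁻ : ∀ {k} (p : Fin k → Bool) → T (any p (allFin k)) → ∃ λ i → T (p i)
any-allFin⁻ {k} p = satisfied ∘ any⁻ p (allFin k)

count-image≤ : ∀ {k l} (P : Fin k → Bool) (f : Fin k → Fin l) →
               count (λ x → any (λ e → P e ∧ x == f e) (allFin k)) ≤ count P
count-image≤ {k} {l} P f = begin
  count (λ x → any (λ e → P e ∧ x == f e) (allFin k))  ≤⟨ ∑-mono-≤ image≤preimages ⟩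
  ∑[ x < l ] ∑[ e < k ] 𝟙 (P e ∧ x == f e)           ≡⟨ ∑-comm (λ x e → 𝟙 (P e ∧ x == f e)) ⟩
  ∑[ e < k ] ∑[ x < l ] 𝟙 (P e ∧ x == f e)           ≡⟨ sum-cong-≗ preimage-size ⟩
  count P                                              ∎
  where
  open ≤-Reasoning
  image≤preimages : ∀ x → 𝟙 (any (λ e → P e ∧ x == f e) (allFin k)) ≤ ∑[ e < k ] 𝟙 (P e ∧ x == f e)
  image≤preimages x with any (λ e → P e ∧ x == f e) (allFin k) in eq
  ... | false = z≤n
  ... | true with e , Pe∧x=fe ← any-allFin⁻ _ (subst T (sym eq) _) =
    ≤-trans (≤-reflexive (sym (𝟙-true Pe∧x=fe))) (term≤∑ (λ e → 𝟙 (P e ∧ x == f e)) e)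
  preimage-size : ∀ e → ∑[ x < l ] 𝟙 (P e ∧ x == f e) ≡ 𝟙 (P e)
  preimage-size e with P e
  ... | true  = count-== (f e)
  ... | false = sum-replicate-zero l

memb≡lookup : ∀ {k} (i : Fin k) (S : Subset k) → memb i S ≡ lookup S i
memb≡lookup i S with lookup S i
... | true  = refl
... | false = refl

memb-tabulate : ∀ {k} (b : Fin k → Bool) i → memb i (tabulate b) ≡ b i
memb-tabulate b i = trans (memb≡lookup i (tabulate b)) (lookup∘tabulate b i)

if-inside-outside : ∀ b → (if b then inside else outside) ≡ b
if-inside-outside true  = refl
if-inside-outside false = refl

memb-tabulate-if : ∀ {k} (b : Fin k → Bool) i →
                   memb i (tabulate (λ v → if b v then inside else outside)) ≡ b i
memb-tabulate-if b i = trans (memb-tabulate _ i) (if-inside-outside (b i))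

∣S∣≡count : ∀ {k} (S : Subset k) → ∣ S ∣ ≡ count (λ i → memb i S)
∣S∣≡count []          = refl
∣S∣≡count (true ∷ S)  = cong suc (∣S∣≡count S)
∣S∣≡count (false ∷ S) = ∣S∣≡count S

∣tabulate∣ : ∀ {k} (b : Fin k → Bool) → ∣ tabulate b ∣ ≡ count b
∣tabulate∣ b = trans (∣S∣≡count (tabulate b)) (sum-cong-≗ (cong 𝟙 ∘ memb-tabulate b))

∈-allSubsets : ∀ {k} (S : Subset k) → S ∈ allSubsets k
∈-allSubsets []                = here refl
∈-allSubsets {suc k} (true ∷ S)  = ∈-++⁺ˡ (∈-map⁺ (inside ∷_) (∈-allSubsets S))
∈-allSubsets {suc k} (false ∷ S) = ∈-++⁺ʳ _ (∈-map⁺ (outside ∷_) (∈-allSubsets S))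

maxℕ-upper : ∀ {x} xs → x ∈ xs → x ≤ maxℕ xs
maxℕ-upper xs = All.lookup
  (foldr-forcesᵇ (λ x y x⊔y≤ → ≤-trans (m≤m⊔n x y) x⊔y≤ , ≤-trans (m≤n⊔m x y) x⊔y≤) 0 xs ≤-refl)

maxℕ-sel : ∀ xs → maxℕ xs ≡ 0 ⊎ maxℕ xs ∈ xs
maxℕ-sel = foldr-selective ⊔-sel 0

maxℤ-upper : ∀ {x} xs → x ∈ xs → x ≤ℤ maxℤ xs
maxℤ-upper xs = All.lookup
  (foldr-forcesᵇ (λ x y x⊔y≤ → ℤ.≤-trans (ℤ.i≤i⊔j x y) x⊔y≤ , ℤ.≤-trans (ℤ.i≤j⊔i x y) x⊔y≤)
                 _ xs ℤ.≤-refl)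

maxℤ-sel : ∀ xs → maxℤ xs ≡ ℤ.+ 0 ⊎ maxℤ xs ∈ xs
maxℤ-sel = foldr-selective ℤ.⊔-sel (ℤ.+ 0)

2*m≤n⇒m≤n/2 : ∀ {m n} → 2 * m ≤ n → m ≤ n / 2
2*m≤n⇒m≤n/2 {m} {n} 2m≤n = begin
  m         ≡⟨ m*n/n≡m m 2 ⟨
  m * 2 / 2 ≤⟨ /-monoˡ-≤ 2 (≤-trans (≤-reflexive (*-comm m 2)) 2m≤n) ⟩
  n / 2     ∎
  where open ≤-Reasoning

[+a]-[+b]≤[+c]-[+d] : ∀ a b c d → a + d ≤ c + b → ℤ.+ a ℤ.- ℤ.+ b ≤ℤ ℤ.+ c ℤ.- ℤ.+ d
[+a]-[+b]≤[+c]-[+d] a b c d a+d≤c+b = begin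
  ℤ.+ a ℤ.- ℤ.+ b       ≡⟨ ℤ.[+m]-[+n]≡m⊖n a b ⟩
  a ⊖ b                  ≡⟨ ℤ.+-cancelˡ-⊖ d a b ⟨
  (d + a) ⊖ (d + b)      ≤⟨ ℤ.⊖-monoˡ-≤ (d + b) (≤-trans (≤-reflexive (+-comm d a))
                                                  (≤-trans a+d≤c+b (≤-reflexive (+-comm c b)))) ⟩
  (b + c) ⊖ (d + b)      ≡⟨ cong ((b + c) ⊖_) (+-comm d b) ⟩
  (b + c) ⊖ (b + d)      ≡⟨ ℤ.+-cancelˡ-⊖ b c d ⟩
  c ⊖ d                  ≡⟨ ℤ.[+m]-[+n]≡m⊖n c d ⟨
  ℤ.+ c ℤ.- ℤ.+ d       ∎
  where open ℤ.≤-Reasoning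

[+a]-[+b]+[+c]≡[+a+c]-[+b] : ∀ a b c → ℤ.+ a ℤ.- ℤ.+ b ℤ.+ ℤ.+ c ≡ ℤ.+ (a + c) ℤ.- ℤ.+ b
[+a]-[+b]+[+c]≡[+a+c]-[+b] a b c = begin
  ℤ.+ a ℤ.- ℤ.+ b ℤ.+ ℤ.+ c ≡⟨ cong (ℤ._+ ℤ.+ c) (ℤ.[+m]-[+n]≡m⊖n a b) ⟩
  a ⊖ b ℤ.+ ℤ.+ c           ≡⟨ ℤ.distribˡ-⊖-+-pos c a b ⟩
  (a + c) ⊖ b               ≡⟨ ℤ.[+m]-[+n]≡m⊖n (a + c) b ⟨
  ℤ.+ (a + c) ℤ.- ℤ.+ b     ∎
  where open ≡-Reasoning

module _ (H : RawGraph) where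

  ∈B⁻ : ∀ {S v} → T (memb v (B H S)) →
        (∃ λ u → T (memb u S) × T (radj H u v)) × ¬ T (memb v S)
  ∈B⁻ {S} {v} v∈B
    with v∈N , v∉S ← Equivalence.to T-∧ (subst T (memb-tabulate-if _ v) v∈B)
    with u , u∈S∧uv ← any-allFin⁻ _ (subst T (memb-tabulate-if _ v) v∈N)
    = (u , Equivalence.to T-∧ u∈S∧uv) , T-not⁻ v∉S

  ∈B⁺ : ∀ {S v} u → T (memb u S) → T (radj H u v) → ¬ T (memb v S) → T (memb v (B H S))
  ∈B⁺ {S} {v} u u∈S uv v∉S = subst T (sym (memb-tabulate-if _ v)) (Equivalence.from T-∧
    ( subst T (sym (memb-tabulate-if _ v)) (any-allFin⁺ _ u (Equivalence.from T-∧ (u∈S , uv)))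
    , T-not⁺ v∉S))

  ∂S≤∂ : ∀ S → ∂S H S ≤ℤ ∂ H
  ∂S≤∂ S = maxℤ-upper _ (∈-map⁺ (∂S H) (∈-allSubsets S))

  ∂-attained : ∃ λ S → ∂S H S ≡ ∂ H
  ∂-attained with maxℤ-sel (List.map (∂S H) (allSubsets (rorder H)))
  ... | inj₂ ∂∈ with S , _ , ∂≡∂S ← ∈-map⁻ (∂S H) ∂∈ = S , sym ∂≡∂S
  ... | inj₁ ∂≡0 = ∅ , ℤ.≤-antisym (∂S≤∂ ∅) (subst (_≤ℤ ∂S H ∅) (sym ∂≡0) 0≤∂S∅)
    where
    0≤∂S∅ : ℤ.+ 0 ≤ℤ ∂S H ∅
    0≤∂S∅ rewrite ∣⊥∣≡0 (rorder H) = ℤ.+≤+ z≤n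

module _ (G : Graph) where

  private
    n = order G
    m = size G

  -- The graph R(G)

  lo hi : Fin m → Fin n
  lo e = proj₁ (List.lookup (edges G) e)
  hi e = proj₂ (List.lookup (edges G) e)

  adj-lo-hi : ∀ e → T (adj G (lo e) (hi e))
  adj-lo-hi e = proj₂ (Equivalence.to T-∧ (proj₂ (∈-filter⁻ candidate? {xs = pairs} (∈-lookup e))))
    where
    candidate? = λ (p : Fin n × Fin n) → T? (⌊ proj₁ p Fin.<? proj₂ p ⌋ ∧ adj G (proj₁ p) (proj₂ p))
    pairs = List.concatMap (λ i → List.map (i ,_) (allFin n)) (allFin n)

  incident : Fin n → Fin m → Bool
  incident x e = x == lo e ∨ x == hi e

  data RVertex : Fin (n + m) → Set where
    vertex : ∀ x → RVertex (x ↑ˡ m)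
    edge   : ∀ e → RVertex (n ↑ʳ e)

  rvertex : ∀ u → RVertex u
  rvertex u with Fin.splitAt n u in eq
  ... | inj₁ x = subst RVertex (splitAt⁻¹-↑ˡ eq) (vertex x)
  ... | inj₂ e = subst RVertex (splitAt⁻¹-↑ʳ eq) (edge e)

  radj-vv : ∀ x y → radj (R G) (x ↑ˡ m) (y ↑ˡ m) ≡ adj G x y
  radj-vv x y rewrite splitAt-↑ˡ n x m | splitAt-↑ˡ n y m = refl

  radj-ve : ∀ x e → radj (R G) (x ↑ˡ m) (n ↑ʳ e) ≡ incident x e
  radj-ve x e rewrite splitAt-↑ˡ n x m | splitAt-↑ʳ n m e = refl

  radj-ev : ∀ e y → radj (R G) (n ↑ʳ e) (y ↑ˡ m) ≡ incident y e
  radj-ev e y rewrite splitAt-↑ˡ n y m | splitAt-↑ʳ n m e = refl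

  radj-ee : ∀ e f → radj (R G) (n ↑ʳ e) (n ↑ʳ f) ≡ false
  radj-ee e f rewrite splitAt-↑ʳ n m e | splitAt-↑ʳ n m f = refl

  inV : Subset (n + m) → Fin n → Bool
  inV S x = memb (x ↑ˡ m) S

  inE : Subset (n + m) → Fin m → Bool
  inE S e = memb (n ↑ʳ e) S

  ∣S∣≡∣S∩V∣+∣S∩E∣ : ∀ S → ∣ S ∣ ≡ count (inV S) + count (inE S)
  ∣S∣≡∣S∩V∣+∣S∩E∣ S = trans (∣S∣≡count S) (∑-↑ n (λ u → 𝟙 (memb u S)))

  NbrV : Subset (n + m) → Fin n → Set
  NbrV S x = (∃ λ y → T (inV S y) × T (adj G y x)) ⊎ (∃ λ e → T (inE S e) × T (incident x e))

  NbrE : Subset (n + m) → Fin m → Set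
  NbrE S e = ∃ λ y → T (inV S y) × T (incident y e)

  ∈B-vertex⁻ : ∀ S x → T (inV (B (R G) S) x) → NbrV S x × ¬ T (inV S x)
  ∈B-vertex⁻ S x x∈B = let (u , u∈S , ux) , x∉S = ∈B⁻ (R G) {S} {x ↑ˡ m} x∈B in nbr (rvertex u) u∈S ux , x∉S
    where
    nbr : ∀ {u} → RVertex u → T (memb u S) → T (radj (R G) u (x ↑ˡ m)) → NbrV S x
    nbr (vertex y) y∈S yx = inj₁ (y , y∈S , subst T (radj-vv y x) yx)
    nbr (edge e)   e∈S ex = inj₂ (e , e∈S , subst T (radj-ev e x) ex)

  ∈B-vertex⁺ : ∀ S x → NbrV S x → ¬ T (inV S x) → T (inV (B (R G) S) x)
  ∈B-vertex⁺ S x (inj₁ (y , y∈S , yx)) = ∈B⁺ (R G) {S} {x ↑ˡ m} (y ↑ˡ m) y∈S (subst T (sym (radj-vv y x)) yx)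
  ∈B-vertex⁺ S x (inj₂ (e , e∈S , ex)) = ∈B⁺ (R G) {S} {x ↑ˡ m} (n ↑ʳ e) e∈S (subst T (sym (radj-ev e x)) ex)

  ∈B-edge⁻ : ∀ S e → T (inE (B (R G) S) e) → NbrE S e × ¬ T (inE S e)
  ∈B-edge⁻ S e e∈B = let (u , u∈S , ue) , e∉S = ∈B⁻ (R G) {S} {n ↑ʳ e} e∈B in nbr (rvertex u) u∈S ue , e∉S
    where
    nbr : ∀ {u} → RVertex u → T (memb u S) → T (radj (R G) u (n ↑ʳ e)) → NbrE S e
    nbr (vertex y) y∈S ye = y , y∈S , subst T (radj-ve y e) ye
    nbr (edge f)   _   fe = ⊥-elim (subst T (radj-ee f e) fe)

  ∈B-edge⁺ : ∀ S e → NbrE S e → ¬ T (inE S e) → T (inE (B (R G) S) e)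
  ∈B-edge⁺ S e (y , y∈S , ye) = ∈B⁺ (R G) {S} {n ↑ʳ e} (y ↑ˡ m) y∈S (subst T (sym (radj-ve y e)) ye)

  vertexSet : (Fin n → Bool) → Subset (n + m)
  vertexSet A = tabulate ([ A , const false ] ∘ Fin.splitAt n)

  inV-vertexSet : ∀ A x → inV (vertexSet A) x ≡ A x
  inV-vertexSet A x = trans (memb-tabulate _ (x ↑ˡ m)) (cong [ A , const false ] (splitAt-↑ˡ n x m))

  inE-vertexSet : ∀ A e → inE (vertexSet A) e ≡ false
  inE-vertexSet A e = trans (memb-tabulate _ (n ↑ʳ e)) (cong [ A , const false ] (splitAt-↑ʳ n m e))

  ∣vertexSet∣ : ∀ A → ∣ vertexSet A ∣ ≡ count A
  ∣vertexSet∣ A = begin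
    ∣ vertexSet A ∣                                    ≡⟨ ∣S∣≡∣S∩V∣+∣S∩E∣ (vertexSet A) ⟩
    count (inV (vertexSet A)) + count (inE (vertexSet A)) ≡⟨ cong₂ _+_ (sum-cong-≗ (cong 𝟙 ∘ inV-vertexSet A))
                                                                       (sum-cong-≗ (cong 𝟙 ∘ inE-vertexSet A)) ⟩
    count A + ∑[ e < m ] 0                             ≡⟨ cong (count A +_) (sum-replicate-zero m) ⟩
    count A + 0                                        ≡⟨ +-identityʳ (count A) ⟩
    count A                                            ∎
    where open ≡-Reasoning

  -- Moving subdivision vertices to endpoints

  loEnds : Subset (n + m) → Fin n → Bool
  loEnds S x = any (λ e → inE S e ∧ x == lo e) (allFin m)

  absorbEdges : Subset (n + m) → Fin n → Bool
  absorbEdges S x = inV S x ∨ loEnds S x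

  ∈vertexSet-absorbEdges : ∀ S {x} → T (absorbEdges S x) → T (inV (vertexSet (absorbEdges S)) x)
  ∈vertexSet-absorbEdges S {x} = subst T (sym (inV-vertexSet (absorbEdges S) x))

  lo∈absorbEdges : ∀ S {e} → T (inE S e) → T (absorbEdges S (lo e))
  lo∈absorbEdges S {e} e∈S =
    Equivalence.from T-∨ (inj₂ (any-allFin⁺ _ e (Equivalence.from T-∧ (e∈S , ==-refl (lo e)))))

  count-absorbEdges : ∀ S → count (absorbEdges S) ≡ count (inV S) + count (λ x → not (inV S x) ∧ loEnds S x)
  count-absorbEdges S = trans (sum-cong-≗ split) (∑-distrib-+ (𝟙 ∘ inV S) (λ x → 𝟙 (not (inV S x) ∧ loEnds S x)))
    where
    split : ∀ x → 𝟙 (absorbEdges S x) ≡ 𝟙 (inV S x) + 𝟙 (not (inV S x) ∧ loEnds S x)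
    split x with inV S x
    ... | true  = refl
    ... | false = refl

  absorbEdges-vertex : ∀ S x → T (inV (B (R G) S) x) →
    T (inV (B (R G) (vertexSet (absorbEdges S))) x) ⊎ T (not (inV S x) ∧ loEnds S x)
  absorbEdges-vertex S x x∈B = let nbr , x∉S = ∈B-vertex⁻ S x x∈B in by-cases x∉S nbr (T? (absorbEdges S x))
    where
    S' = vertexSet (absorbEdges S)
    nbr' : ¬ T (absorbEdges S x) → NbrV S x → NbrV S' x
    nbr' _ (inj₁ (y , y∈S , yx)) = inj₁ (y , ∈vertexSet-absorbEdges S (Equivalence.from T-∨ (inj₁ y∈S)) , yx)
    nbr' x∉S' (inj₂ (e , e∈S , x∈e)) = [ at-lo , at-hi ]′ (Equivalence.to T-∨ x∈e)
      where
      at-lo : T (x == lo e) → NbrV S' x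
      at-lo x=lo = ⊥-elim (x∉S' (Equivalence.from T-∨ (inj₂ (any-allFin⁺ _ e (Equivalence.from T-∧ (e∈S , x=lo))))))
      at-hi : T (x == hi e) → NbrV S' x
      at-hi x=hi = inj₁ (lo e , ∈vertexSet-absorbEdges S (lo∈absorbEdges S e∈S)
                             , subst (T ∘ adj G (lo e)) (sym (==⇒≡ x=hi)) (adj-lo-hi e))
    by-cases : ¬ T (inV S x) → NbrV S x → Dec (T (absorbEdges S x)) →
               T (inV (B (R G) S') x) ⊎ T (not (inV S x) ∧ loEnds S x)
    by-cases x∉S nbr (no x∉S')  =
      inj₁ (∈B-vertex⁺ S' x (nbr' x∉S' nbr) (x∉S' ∘ subst T (inV-vertexSet (absorbEdges S) x)))
    by-cases x∉S nbr (yes x∈S') =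
      inj₂ (Equivalence.from T-∧ (T-not⁺ x∉S , [ ⊥-elim ∘ x∉S , id ]′ (Equivalence.to T-∨ x∈S')))

  absorbEdges-edge : ∀ S e → T (inE (B (R G) S) e) ⊎ T (inE S e) →
                     T (inE (B (R G) (vertexSet (absorbEdges S))) e)
  absorbEdges-edge S e e∈B⊎S =
    ∈B-edge⁺ S' e ([ from-boundary , from-S ]′ e∈B⊎S) (subst T (inE-vertexSet (absorbEdges S) e))
    where
    S' = vertexSet (absorbEdges S)
    from-boundary : T (inE (B (R G) S) e) → NbrE S' e
    from-boundary e∈B = let y , y∈S , y∈e = proj₁ (∈B-edge⁻ S e e∈B)
                        in y , ∈vertexSet-absorbEdges S (Equivalence.from T-∨ (inj₁ y∈S)) , y∈e
    from-S : T (inE S e) → NbrE S' e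
    from-S e∈S = lo e , ∈vertexSet-absorbEdges S (lo∈absorbEdges S e∈S)
                      , Equivalence.from T-∨ (inj₁ (==-refl (lo e)))

  -- A dropped v_e enters the boundary and pays for the new vertex lo e; a vertex can only leave
  -- the boundary by becoming such a new vertex.
  ∂S≤∂S-absorbEdges : ∀ S → ∂S (R G) S ≤ℤ ∂S (R G) (vertexSet (absorbEdges S))
  ∂S≤∂S-absorbEdges S = [+a]-[+b]≤[+c]-[+d] (∣ B (R G) S ∣) (∣ S ∣) (∣ B (R G) S' ∣) (∣ S' ∣) (begin
    ∣ B (R G) S ∣ + ∣ S' ∣
      ≡⟨ cong₂ _+_ (∣S∣≡∣S∩V∣+∣S∩E∣ (B (R G) S)) (trans (∣vertexSet∣ (absorbEdges S)) (count-absorbEdges S)) ⟩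
    (count (inV (B (R G) S)) + count (inE (B (R G) S))) + (count (inV S) + count new)
      ≤⟨ rearrange vertices-step edges-step new≤edges ⟩
    (count (inV (B (R G) S')) + count (inE (B (R G) S'))) + (count (inV S) + count (inE S))
      ≡⟨ cong₂ _+_ (∣S∣≡∣S∩V∣+∣S∩E∣ (B (R G) S')) (∣S∣≡∣S∩V∣+∣S∩E∣ S) ⟨
    ∣ B (R G) S' ∣ + ∣ S ∣ ∎)
    where
    open ≤-Reasoning
    S' = vertexSet (absorbEdges S)
    new : Fin n → Bool
    new x = not (inV S x) ∧ loEnds S x

    vertices-step : count (inV (B (R G) S)) ≤ count (inV (B (R G) S')) + count new
    vertices-step = ≤-trans (∑-mono-≤ λ x → 𝟙-≤-+ (absorbEdges-vertex S x))
                            (≤-reflexive (∑-distrib-+ (𝟙 ∘ inV (B (R G) S')) (𝟙 ∘ new)))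

    edges-step : count (inE (B (R G) S)) + count (inE S) ≤ count (inE (B (R G) S'))
    edges-step = ≤-trans (≤-reflexive (sym (∑-distrib-+ (𝟙 ∘ inE (B (R G) S)) (𝟙 ∘ inE S))))
      (∑-mono-≤ λ e → 𝟙-+-≤ (λ e∈B → proj₂ (∈B-edge⁻ S e e∈B)) (absorbEdges-edge S e ∘ inj₁) (absorbEdges-edge S e ∘ inj₂))

    new≤edges : count new ≤ count (inE S)
    new≤edges = ≤-trans (∑-mono-≤ λ x → 𝟙-mono {new x} {loEnds S x} (proj₂ ∘ Equivalence.to T-∧))
                        (count-image≤ (inE S) lo)

    rearrange : ∀ {bV bE bV' bE' a c k} → bV ≤ bV' + c → bE + k ≤ bE' → c ≤ k →
                (bV + bE) + (a + c) ≤ (bV' + bE') + (a + k)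
    rearrange {bV} {bE} {bV'} {bE'} {a} {c} {k} hV hE c≤k = begin
      (bV + bE) + (a + c)        ≤⟨ +-mono-≤ (+-monoˡ-≤ bE hV) (+-monoʳ-≤ a c≤k) ⟩
      (bV' + c + bE) + (a + k)   ≤⟨ +-monoˡ-≤ (a + k) (≤-trans (≤-reflexive (swap bV' c bE)) (+-monoʳ-≤ bV' (+-monoʳ-≤ bE c≤k))) ⟩
      (bV' + (bE + k)) + (a + k) ≤⟨ +-monoˡ-≤ (a + k) (+-monoʳ-≤ bV' hE) ⟩
      (bV' + bE') + (a + k)      ∎
      where
      swap : ∀ x y z → x + y + z ≡ x + (z + y)
      swap = solve-∀

  ∃-differential-vertexSet : ∃ λ A → ∂S (R G) (vertexSet A) ≡ ∂ (R G)
  ∃-differential-vertexSet =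
    let S , ∂S≡∂ = ∂-attained (R G)
        S' = vertexSet (absorbEdges S)
    in absorbEdges S , ℤ.≤-antisym (∂S≤∂ (R G) S') (subst (_≤ℤ ∂S (R G) S') ∂S≡∂ (∂S≤∂S-absorbEdges S))

  differentialInV : Subset (n + m) → Bool
  differentialInV S = InV G S ∧ ⌊ ∂S (R G) S ℤ.≟ ∂ (R G) ⌋

  μ-attained : ∃ λ D → (∀ e → ¬ T (inE D e)) × ∂S (R G) D ≡ ∂ (R G) × μ G ≤ ∣ D ∣
  μ-attained = from-max (maxℕ-sel (List.map ∣_∣ candidates))
    where
    candidates : List (Subset (n + m))
    candidates = List.filter (T? ∘ differentialInV) (allSubsets (n + m))
    from-candidate : ∀ D → D ∈ candidates → μ G ≡ ∣ D ∣ →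
                     ∃ λ D → (∀ e → ¬ T (inE D e)) × ∂S (R G) D ≡ ∂ (R G) × μ G ≤ ∣ D ∣
    from-candidate D D∈ μ≡∣D∣ =
      let D⊆V , D-differential = Equivalence.to (T-∧ {InV G D})
                                   (proj₂ (∈-filter⁻ (T? ∘ differentialInV) {xs = allSubsets (n + m)} D∈))
      in D , (λ e e∈D → T-not⁻ D⊆V (any-allFin⁺ _ e e∈D)) , toWitness D-differential , ≤-reflexive μ≡∣D∣
    from-max : μ G ≡ 0 ⊎ μ G ∈ List.map ∣_∣ candidates →
               ∃ λ D → (∀ e → ¬ T (inE D e)) × ∂S (R G) D ≡ ∂ (R G) × μ G ≤ ∣ D ∣
    from-max (inj₁ μ≡0) =
      let A , ∂A≡∂ = ∃-differential-vertexSet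
      in vertexSet A , (λ e → subst T (inE-vertexSet A e)) , ∂A≡∂ , ≤-trans (≤-reflexive μ≡0) z≤n
    from-max (inj₂ μ∈) = let D , D∈ , μ≡∣D∣ = ∈-map⁻ ∣_∣ μ∈ in from-candidate D D∈ μ≡∣D∣

  inducedEdges : (Fin n → Bool) → ℕ
  inducedEdges P = ∑[ e < m ] 𝟙 (P (lo e) ∧ P (hi e))

  ∣B∣+inducedEdges≤ : ∀ S → ∣ B (R G) S ∣ + inducedEdges (not ∘ inV S) ≤ count (not ∘ inV S) + m
  ∣B∣+inducedEdges≤ S = begin
    ∣ B (R G) S ∣ + inducedEdges (not ∘ inV S)
      ≡⟨ cong (_+ inducedEdges (not ∘ inV S)) (∣S∣≡∣S∩V∣+∣S∩E∣ (B (R G) S)) ⟩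
    count (inV (B (R G) S)) + count (inE (B (R G) S)) + inducedEdges (not ∘ inV S)
      ≡⟨ +-assoc (count (inV (B (R G) S))) _ _ ⟩
    count (inV (B (R G) S)) + (count (inE (B (R G) S)) + inducedEdges (not ∘ inV S))
      ≤⟨ +-mono-≤ (∑-mono-≤ vertex-bound)
                  (≤-trans (≤-reflexive (sym (∑-distrib-+ (𝟙 ∘ inE (B (R G) S))
                                                          (λ e → 𝟙 (not (inV S (lo e)) ∧ not (inV S (hi e)))))))
                           (∑-mono-≤ edge-bound)) ⟩
    count (not ∘ inV S) + count {m} (const true)
      ≡⟨ cong (count (not ∘ inV S) +_) (count-true m) ⟩
    count (not ∘ inV S) + m ∎
    where
    open ≤-Reasoning
    vertex-bound : ∀ x → 𝟙 (inV (B (R G) S) x) ≤ 𝟙 (not (inV S x))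
    vertex-bound x = 𝟙-mono (T-not⁺ ∘ proj₂ ∘ ∈B-vertex⁻ S x)

    edge-bound : ∀ e → 𝟙 (inE (B (R G) S) e) + 𝟙 (not (inV S (lo e)) ∧ not (inV S (hi e))) ≤ 1
    edge-bound e = 𝟙-+-≤ {c = true} outside-both _ _
      where
      outside-both : T (inE (B (R G) S) e) → ¬ T (not (inV S (lo e)) ∧ not (inV S (hi e)))
      outside-both e∈B lo∉S∧hi∉S = endpoint-in-S (proj₁ (∈B-edge⁻ S e e∈B))
        where
        lo∉S : ¬ T (inV S (lo e))
        lo∉S = T-not⁻ (proj₁ (Equivalence.to (T-∧ {not (inV S (lo e))}) lo∉S∧hi∉S))
        hi∉S : ¬ T (inV S (hi e))
        hi∉S = T-not⁻ (proj₂ (Equivalence.to (T-∧ {not (inV S (lo e))}) lo∉S∧hi∉S))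
        endpoint-in-S : NbrE S e → ⊥
        endpoint-in-S (y , y∈S , y∈e) =
          [ (λ y=lo → lo∉S (subst (T ∘ inV S) (==⇒≡ y=lo) y∈S))
          , (λ y=hi → hi∉S (subst (T ∘ inV S) (==⇒≡ y=hi) y∈S)) ]′ (Equivalence.to T-∨ y∈e)

  IsIndependent : (Fin n → Bool) → Set
  IsIndependent P = ∀ u v → T (P u) → T (P v) → ¬ T (adj G u v)

  connected⇒neighbour : Connected G → 2 ≤ n → ∀ x → ∃ λ y → T (adj G x y)
  connected⇒neighbour conn 2≤n x = let y , x≢y = ∃-≢ 2≤n x in first-step (conn x y) x≢y
    where
    first-step : ∀ {x y} → Reach G x y → x ≢ y → ∃ λ z → T (adj G x z)
    first-step here         x≢x = ⊥-elim (x≢x refl)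
    first-step (step xz _) _   = _ , xz

  count+m≤∣B∣ : ∀ P → IsIndependent P → (∀ x → ∃ λ y → T (adj G x y)) →
                count P + m ≤ ∣ B (R G) (vertexSet (not ∘ P)) ∣
  count+m≤∣B∣ P indep nbr = begin
    count P + m                                    ≡⟨ cong (count P +_) (count-true m) ⟨
    count P + count {m} (const true)               ≤⟨ +-mono-≤ (∑-mono-≤ vertex-bound) (∑-mono-≤ edge-bound) ⟩
    count (inV (B (R G) S)) + count (inE (B (R G) S)) ≡⟨ ∣S∣≡∣S∩V∣+∣S∩E∣ (B (R G) S) ⟨
    ∣ B (R G) S ∣                                  ∎
    where
    open ≤-Reasoning
    S = vertexSet (not ∘ P)

    ∈S : ∀ {y} → ¬ T (P y) → T (inV S y)
    ∈S {y} y∉P = subst T (sym (inV-vertexSet (not ∘ P) y)) (T-not⁺ y∉P)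

    ∉S : ∀ {x} → T (P x) → ¬ T (inV S x)
    ∉S {x} x∈P x∈S = T-not⁻ (subst T (inV-vertexSet (not ∘ P) x) x∈S) x∈P

    vertex-bound : ∀ x → 𝟙 (P x) ≤ 𝟙 (inV (B (R G) S) x)
    vertex-bound x = 𝟙-mono λ x∈P →
      let y , xy = nbr x
          y∉P = λ y∈P → indep x y x∈P y∈P xy
      in ∈B-vertex⁺ S x (inj₁ (y , ∈S y∉P , subst T (adj-sym G x y) xy)) (∉S x∈P)

    edge-bound : ∀ e → 1 ≤ 𝟙 (inE (B (R G) S) e)
    edge-bound e = 𝟙-mono {true} λ _ → ∈B-edge⁺ S e (endpoint-outside (T? (P (lo e)))) (subst T (inE-vertexSet _ e))
      where
      endpoint-outside : Dec (T (P (lo e))) → NbrE S e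
      endpoint-outside (no lo∉P)  = lo e , ∈S lo∉P , Equivalence.from T-∨ (inj₁ (==-refl (lo e)))
      endpoint-outside (yes lo∈P) = hi e , ∈S (λ hi∈P → indep _ _ lo∈P hi∈P (adj-lo-hi e))
                                         , Equivalence.from T-∨ (inj₂ (==-refl (hi e)))

  -- Counting edges of induced subgraphs

  ∑-edges : ∀ (g : Fin n → Fin n → ℕ) →
            ∑[ e < m ] g (lo e) (hi e) ≡ ∑[ i < n ] ∑[ j < n ] (𝟙 (i <ᵇ j ∧ adj G i j) * g i j)
  ∑-edges g = begin
    ∑[ e < m ] g (lo e) (hi e)
      ≡⟨ ∑-lookup (edges G) (uncurry g) ⟩
    sumᴸ (List.map (uncurry g) (edges G))
      ≡⟨ sumᴸ-map-filter isEdge (uncurry g) (List.concatMap row (allFin n)) ⟩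
    sumᴸ (List.map weighted (List.concatMap row (allFin n)))
      ≡⟨ sumᴸ-map-concatMap row weighted (allFin n) ⟩
    sumᴸ (List.map (sumᴸ ∘ List.map weighted ∘ row) (allFin n))
      ≡⟨ cong sumᴸ (map-cong row-sum (allFin n)) ⟩
    sumᴸ (List.map (λ i → ∑[ j < n ] weighted (i , j)) (allFin n))
      ≡⟨ sumᴸ-map-allFin (λ i → ∑[ j < n ] weighted (i , j)) ⟩
    ∑[ i < n ] ∑[ j < n ] weighted (i , j) ∎
    where
    open ≡-Reasoning
    isEdge : Fin n × Fin n → Bool
    isEdge (i , j) = i <ᵇ j ∧ adj G i j
    weighted : Fin n × Fin n → ℕ
    weighted p = 𝟙 (isEdge p) * uncurry g p
    row : Fin n → List (Fin n × Fin n)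
    row i = List.map (i ,_) (allFin n)
    row-sum : ∀ i → sumᴸ (List.map weighted (row i)) ≡ ∑[ j < n ] weighted (i , j)
    row-sum i = trans (cong sumᴸ (sym (map-∘ (allFin n)))) (sumᴸ-map-allFin (λ j → weighted (i , j)))

  adjPair : (Fin n → Bool) → Fin n → Fin n → ℕ
  adjPair P i j = 𝟙 (P i ∧ adj G i j ∧ P j)

  adjPairs : (Fin n → Bool) → ℕ
  adjPairs P = ∑[ i < n ] ∑[ j < n ] adjPair P i j

  adjPair-irrefl : ∀ P i → adjPair P i i ≡ 0
  adjPair-irrefl P i rewrite adj-irr G i = cong 𝟙 (∧-zeroʳ (P i))

  adjPair-sym : ∀ P i j → adjPair P i j ≡ adjPair P j i
  adjPair-sym P i j rewrite adj-sym G i j = cong 𝟙 (swap (P i) (adj G j i) (P j))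
    where
    swap : ∀ p a q → p ∧ a ∧ q ≡ q ∧ a ∧ p
    swap true  a true  = refl
    swap true  a false = ∧-zeroʳ a
    swap false a true  = sym (∧-zeroʳ a)
    swap false a false = refl

  inducedEdges≡∑∑< : ∀ P → inducedEdges P ≡ ∑[ i < n ] ∑[ j < n ] (𝟙 (i <ᵇ j) * adjPair P i j)
  inducedEdges≡∑∑< P = trans (∑-edges λ i j → 𝟙 (P i ∧ P j))
    (sum-cong-≗ λ i → sum-cong-≗ λ j → reorder (i <ᵇ j) (P i) (adj G i j) (P j))
    where
    reorder : ∀ l p a q → 𝟙 (l ∧ a) * 𝟙 (p ∧ q) ≡ 𝟙 l * 𝟙 (p ∧ a ∧ q)
    reorder false p     a     q = refl
    reorder true  true  true  q = refl
    reorder true  true  false q = refl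
    reorder true  false a     q = *-zeroʳ (𝟙 a)

  adjPairs≡2*inducedEdges : ∀ P → adjPairs P ≡ 2 * inducedEdges P
  adjPairs≡2*inducedEdges P = begin
    adjPairs P                                                 ≡⟨ ∑∑-split-< (adjPair P) (adjPair-irrefl P) ⟩
    e + ∑[ i < n ] ∑[ j < n ] (𝟙 (j <ᵇ i) * adjPair P i j)   ≡⟨ cong (e +_) (∑∑-swap-< (adjPair P) (adjPair-sym P)) ⟩
    e + e                                                      ≡⟨ cong (e +_) (+-identityʳ e) ⟨
    2 * e                                                      ≡⟨ cong (2 *_) (inducedEdges≡∑∑< P) ⟨
    2 * inducedEdges P                                         ∎
    where
    open ≡-Reasoning
    e = ∑[ i < n ] ∑[ j < n ] (𝟙 (i <ᵇ j) * adjPair P i j)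

  degIn : (Fin n → Bool) → Fin n → ℕ
  degIn P v = ∑[ j < n ] 𝟙 (adj G v j ∧ P j)

  adjPair-∖ : ∀ P {v} → T (P v) → ∀ i j →
    adjPair P i j ≡ adjPair (P ∖ v) i j + 𝟙 (i == v) * 𝟙 (adj G i j ∧ P j) + 𝟙 (j == v) * 𝟙 (adj G i j ∧ P i)
  adjPair-∖ P {v} Pv i j with i Fin.≟ v | j Fin.≟ v
  ... | yes refl | yes refl rewrite adj-irr G i | Equivalence.to T-≡ Pv = refl
  ... | yes refl | no _     rewrite Equivalence.to T-≡ Pv = sym (trans (+-identityʳ _) (+-identityʳ _))
  ... | no _     | yes refl rewrite Equivalence.to T-≡ Pv = edge-into-v (P i) (adj G i j)
    where
    edge-into-v : ∀ p a → 𝟙 (p ∧ a ∧ true) ≡ 𝟙 ((p ∧ true) ∧ a ∧ false) + 0 + 1 * 𝟙 (a ∧ p)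
    edge-into-v true  true  = refl
    edge-into-v true  false = refl
    edge-into-v false true  = refl
    edge-into-v false false = refl
  ... | no _     | no _     rewrite ∧-identityʳ (P i) | ∧-identityʳ (P j) = sym (trans (+-identityʳ _) (+-identityʳ _))

  adjPairs-∖ : ∀ P {v} → T (P v) → adjPairs P ≡ adjPairs (P ∖ v) + 2 * degIn P v
  adjPairs-∖ P {v} Pv = begin
    adjPairs P
      ≡⟨ sum-cong-≗ (λ i → sum-cong-≗ (adjPair-∖ P Pv i)) ⟩
    ∑[ i < n ] ∑[ j < n ] (adjPair (P ∖ v) i j + from-v i j + to-v i j)
      ≡⟨ ∑∑-distrib-+ (λ i j → adjPair (P ∖ v) i j + from-v i j) to-v ⟩
    ∑[ i < n ] ∑[ j < n ] (adjPair (P ∖ v) i j + from-v i j) + ∑[ i < n ] ∑[ j < n ] to-v i j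
      ≡⟨ cong₂ _+_ (∑∑-distrib-+ (adjPair (P ∖ v)) from-v) ∑∑to-v ⟩
    adjPairs (P ∖ v) + ∑[ i < n ] ∑[ j < n ] from-v i j + degIn P v
      ≡⟨ cong (λ x → adjPairs (P ∖ v) + x + degIn P v) ∑∑from-v ⟩
    adjPairs (P ∖ v) + degIn P v + degIn P v
      ≡⟨ double (adjPairs (P ∖ v)) (degIn P v) ⟩
    adjPairs (P ∖ v) + 2 * degIn P v ∎
    where
    open ≡-Reasoning
    double : ∀ a d → a + d + d ≡ a + 2 * d
    double = solve-∀
    from-v to-v : Fin n → Fin n → ℕ
    from-v i j = 𝟙 (i == v) * 𝟙 (adj G i j ∧ P j)
    to-v i j = 𝟙 (j == v) * 𝟙 (adj G i j ∧ P i)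

    ∑∑from-v : ∑[ i < n ] ∑[ j < n ] from-v i j ≡ degIn P v
    ∑∑from-v = trans (sum-cong-≗ λ i → sym (*-distribˡ-sum (𝟙 (i == v)) λ j → 𝟙 (adj G i j ∧ P j)))
                     (∑-== (degIn P) v)

    ∑∑to-v : ∑[ i < n ] ∑[ j < n ] to-v i j ≡ degIn P v
    ∑∑to-v = sum-cong-≗ λ i → trans (∑-== (λ j → 𝟙 (adj G i j ∧ P i)) v)
                                     (cong (λ a → 𝟙 (a ∧ P i)) (adj-sym G i v))

  inducedEdges-∖ : ∀ P {v} → T (P v) → inducedEdges P ≡ inducedEdges (P ∖ v) + degIn P v
  inducedEdges-∖ P {v} Pv = *-cancelˡ-≡ _ _ 2 (begin
    2 * inducedEdges P                         ≡⟨ adjPairs≡2*inducedEdges P ⟨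
    adjPairs P                                 ≡⟨ adjPairs-∖ P Pv ⟩
    adjPairs (P ∖ v) + 2 * degIn P v           ≡⟨ cong (_+ 2 * degIn P v) (adjPairs≡2*inducedEdges (P ∖ v)) ⟩
    2 * inducedEdges (P ∖ v) + 2 * degIn P v   ≡⟨ *-distribˡ-+ 2 (inducedEdges (P ∖ v)) (degIn P v) ⟨
    2 * (inducedEdges (P ∖ v) + degIn P v)     ∎)
    where open ≡-Reasoning

  2*inducedEdges≤count : ∀ P → (∀ v → T (P v) → degIn P v ≤ 1) → 2 * inducedEdges P ≤ count P
  2*inducedEdges≤count P maxdeg≤1 = begin
    2 * inducedEdges P ≡⟨ adjPairs≡2*inducedEdges P ⟨
    adjPairs P         ≤⟨ ∑-mono-≤ row≤ ⟩
    count P            ∎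
    where
    open ≤-Reasoning
    row≤ : ∀ i → ∑[ j < n ] adjPair P i j ≤ 𝟙 (P i)
    row≤ i with P i in Pi
    ... | true  = maxdeg≤1 i (Equivalence.from T-≡ Pi)
    ... | false = ≤-reflexive (sum-replicate-zero n)

  Independent⇒ : ∀ S → T (Independent G S) → IsIndependent (λ u → memb u S)
  Independent⇒ S indep u v u∈S v∈S uv = T-not⁻ indep
    (any-allFin⁺ _ u (any-allFin⁺ _ v (Equivalence.from T-∧ (u∈S , Equivalence.from T-∧ (v∈S , uv)))))

  ⇒Independent : ∀ S → IsIndependent (λ u → memb u S) → T (Independent G S)
  ⇒Independent S indep = T-not⁺ λ edge-in-S →
    let u , u-edge = any-allFin⁻ _ edge-in-S
        v , uv-edge = any-allFin⁻ _ u-edge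
        u∈S , v∈S∧uv = Equivalence.to T-∧ uv-edge
        v∈S , uv = Equivalence.to T-∧ v∈S∧uv
    in indep u v u∈S v∈S uv

  ∣S∣≤α : ∀ S → IsIndependent (λ u → memb u S) → ∣ S ∣ ≤ α G
  ∣S∣≤α S indep = maxℕ-upper _
    (∈-map⁺ ∣_∣ (∈-filter⁺ (T? ∘ Independent G) (∈-allSubsets S) (⇒Independent S indep)))

  α-attained : ∃ λ S → IsIndependent (λ u → memb u S) × ∣ S ∣ ≡ α G
  α-attained with maxℕ-sel (List.map ∣_∣ (List.filter (T? ∘ Independent G) (allSubsets n)))
  ... | inj₂ α∈ with S , S∈ , α≡∣S∣ ← ∈-map⁻ ∣_∣ α∈ =
    S , Independent⇒ S (proj₂ (∈-filter⁻ (T? ∘ Independent G) {xs = allSubsets n} S∈)) , sym α≡∣S∣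
  ... | inj₁ α≡0 = ∅ , ∅-independent , trans (∣⊥∣≡0 n) (sym α≡0)
    where
    ∅-independent : IsIndependent (λ u → memb u ∅)
    ∅-independent u _ u∈∅ _ _ = subst T (trans (memb≡lookup u ∅) (lookup-replicate u outside)) u∈∅

  localMinima : (Fin n → Bool) → Fin n → Bool
  localMinima P x = P x ∧ not (any (λ j → j <ᵇ x ∧ adj G x j ∧ P j) (allFin n))

  localMinima-independent : ∀ P → IsIndependent (localMinima P)
  localMinima-independent P u v u∈ v∈ uv = by-order (Finₚ.<-cmp u v)
    where
    in-P : ∀ {x} → T (localMinima P x) → T (P x)
    in-P = proj₁ ∘ Equivalence.to T-∧
    not-minimal : ∀ {x y} → T (localMinima P y) → T (x <ᵇ y) → T (adj G y x) → T (P x) → ⊥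
    not-minimal {x} y∈ x<y yx Px = T-not⁻ (proj₂ (Equivalence.to T-∧ y∈))
      (any-allFin⁺ _ x (Equivalence.from T-∧ (x<y , Equivalence.from T-∧ (yx , Px))))
    by-order : Tri (u Fin.< v) (u ≡ v) (v Fin.< u) → ⊥
    by-order (tri< u<v _ _)  = not-minimal v∈ (<⇒<ᵇ u<v) (subst T (adj-sym G u v) uv) (in-P u∈)
    by-order (tri> _ _ v<u)  = not-minimal u∈ (<⇒<ᵇ v<u) uv (in-P v∈)
    by-order (tri≈ _ refl _) = subst T (adj-irr G u) uv

  -- A vertex of P that is not a local minimum is charged to an edge of G[P] towards a smaller vertex.
  count≤count-localMinima+inducedEdges : ∀ P → count P ≤ count (localMinima P) + inducedEdges P
  count≤count-localMinima+inducedEdges P = begin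
    count P
      ≤⟨ ∑-mono-≤ minimal-or-lower-edge ⟩
    ∑[ x < n ] (𝟙 (localMinima P x) + ∑[ j < n ] (𝟙 (j <ᵇ x) * adjPair P x j))
      ≡⟨ ∑-distrib-+ (𝟙 ∘ localMinima P) (λ x → ∑[ j < n ] (𝟙 (j <ᵇ x) * adjPair P x j)) ⟩
    count (localMinima P) + ∑[ x < n ] ∑[ j < n ] (𝟙 (j <ᵇ x) * adjPair P x j)
      ≡⟨ cong (count (localMinima P) +_) (trans (∑∑-swap-< (adjPair P) (adjPair-sym P)) (sym (inducedEdges≡∑∑< P))) ⟩
    count (localMinima P) + inducedEdges P ∎
    where
    open ≤-Reasoning
    minimal-or-lower-edge : ∀ x → 𝟙 (P x) ≤ 𝟙 (localMinima P x) + ∑[ j < n ] (𝟙 (j <ᵇ x) * adjPair P x j)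
    minimal-or-lower-edge x with T? (any (λ j → j <ᵇ x ∧ adj G x j ∧ P j) (allFin n))
    ... | no no-lower = ≤-trans (𝟙-mono λ Px → Equivalence.from T-∧ (Px , T-not⁺ no-lower)) (m≤m+n _ _)
    ... | yes lower with j , j<x∧xj∧Pj ← any-allFin⁻ _ lower
                     with j<x , xj∧Pj ← Equivalence.to (T-∧ {j <ᵇ x}) j<x∧xj∧Pj = begin
      𝟙 (P x)                                      ≤⟨ 𝟙-mono (λ Px → Equivalence.from T-∧ (Px , xj∧Pj)) ⟩
      adjPair P x j                                ≡⟨ *-identityˡ (adjPair P x j) ⟨
      1 * adjPair P x j                            ≡⟨ cong (_* adjPair P x j) (𝟙-true {j <ᵇ x} j<x) ⟨
      𝟙 (j <ᵇ x) * adjPair P x j                   ≤⟨ term≤∑ (λ j → 𝟙 (j <ᵇ x) * adjPair P x j) j ⟩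
      ∑[ j < n ] (𝟙 (j <ᵇ x) * adjPair P x j)      ≤⟨ m≤n+m _ _ ⟩
      𝟙 (localMinima P x) + ∑[ j < n ] (𝟙 (j <ᵇ x) * adjPair P x j) ∎

  2*count≤2*α+inducedEdges+count/2-sparse : ∀ P → (∀ v → T (P v) → degIn P v ≤ 1) →
    2 * count P ≤ 2 * α G + inducedEdges P + count P / 2
  2*count≤2*α+inducedEdges+count/2-sparse P maxdeg≤1 = begin
    2 * count P                                ≤⟨ *-monoʳ-≤ 2 (≤-trans (count≤count-localMinima+inducedEdges P)
                                                                       (+-monoˡ-≤ e minima≤α)) ⟩
    2 * (α G + e)                              ≡⟨ distribute (α G) e ⟩
    2 * α G + e + e                            ≤⟨ +-monoʳ-≤ (2 * α G + e) (2*m≤n⇒m≤n/2 (2*inducedEdges≤count P maxdeg≤1)) ⟩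
    2 * α G + e + count P / 2                  ∎
    where
    open ≤-Reasoning
    e = inducedEdges P
    minima = tabulate (localMinima P)
    minima≤α : count (localMinima P) ≤ α G
    minima≤α = ≤-trans (≤-reflexive (sym (∣tabulate∣ (localMinima P)))) (∣S∣≤α minima λ u v u∈ v∈ →
      localMinima-independent P u v (subst T (memb-tabulate _ u) u∈) (subst T (memb-tabulate _ v) v∈))
    distribute : ∀ a e → 2 * (a + e) ≡ 2 * a + e + e
    distribute = solve-∀

  -- Deleting a vertex of degree at least 2 in G[P] lowers the left side by 2 and the right side by at
  -- least 2, so it suffices to treat G[P] of maximum degree at most 1.
  2*count≤2*α+inducedEdges+count/2 : ∀ P → 2 * count P ≤ 2 * α G + inducedEdges P + count P / 2
  2*count≤2*α+inducedEdges+count/2 P = bounded (count P) P ≤-refl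
    where
    delete-step : ∀ {a e t d} → 2 ≤ d → 2 * t ≤ 2 * a + e + t / 2 → 2 * suc t ≤ 2 * a + (e + d) + suc t / 2
    delete-step {a} {e} {t} {d} 2≤d ih = begin
      2 * suc t                      ≡⟨ *-suc 2 t ⟩
      2 + 2 * t                      ≤⟨ +-mono-≤ 2≤d ih ⟩
      d + (2 * a + e + t / 2)        ≤⟨ +-monoʳ-≤ d (+-monoʳ-≤ (2 * a + e) (/-monoˡ-≤ 2 (n≤1+n t))) ⟩
      d + (2 * a + e + suc t / 2)    ≡⟨ rearrange a e d (suc t / 2) ⟩
      2 * a + (e + d) + suc t / 2    ∎
      where
      open ≤-Reasoning
      rearrange : ∀ a e d h → d + (2 * a + e + h) ≡ 2 * a + (e + d) + h
      rearrange = solve-∀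
    bounded : ∀ k P → count P ≤ k → 2 * count P ≤ 2 * α G + inducedEdges P + count P / 2
    bounded k P _ with any? (λ v → T? (P v) ×-dec (2 ≤? degIn P v))
    ... | no no-high = 2*count≤2*α+inducedEdges+count/2-sparse P λ v Pv →
      ≤-pred (≰⇒> λ 2≤d → no-high (v , Pv , 2≤d))
    bounded zero    P c≤0   | yes (v , Pv , _) with () ← subst (_≤ 0) (count-∖ P Pv) c≤0
    bounded (suc k) P c≤1+k | yes (v , Pv , 2≤d) rewrite count-∖ P Pv | inducedEdges-∖ P Pv =
      delete-step {α G} 2≤d (bounded k (P ∖ v) (≤-pred c≤1+k))

  λG≤∂ : Connected G → 3 ≤ n → λG G ≤ℤ ∂ (R G)
  λG≤∂ conn 3≤n = let I , I-independent , ∣I∣≡α = α-attained in from-independent I I-independent ∣I∣≡α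
    where
    complement : Subset n → Subset (n + m)
    complement I = vertexSet (λ u → not (memb u I))

    counting : ∀ I → IsIndependent (λ u → memb u I) → ∣ I ∣ ≡ α G →
               m + 2 * α G + ∣ complement I ∣ ≤ ∣ B (R G) (complement I) ∣ + n
    counting I I-independent ∣I∣≡α = begin
      m + 2 * α G + ∣ complement I ∣
        ≡⟨ cong₂ (λ a s → m + 2 * a + s) (trans (sym ∣I∣≡α) (∣S∣≡count I)) (∣vertexSet∣ (not ∘ P)) ⟩
      m + 2 * count P + count (not ∘ P)
        ≡⟨ rearrange m (count P) (count (not ∘ P)) ⟩
      (count P + m) + (count P + count (not ∘ P))
        ≤⟨ +-mono-≤ (count+m≤∣B∣ P I-independent (connected⇒neighbour conn (≤-trans (n≤1+n 2) 3≤n)))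
                    (≤-reflexive (count+count-not P)) ⟩
      ∣ B (R G) (complement I) ∣ + n ∎
      where
      open ≤-Reasoning
      P : Fin n → Bool
      P u = memb u I
      rearrange : ∀ m i o → m + 2 * i + o ≡ (i + m) + (i + o)
      rearrange = solve-∀

    from-independent : ∀ I → IsIndependent (λ u → memb u I) → ∣ I ∣ ≡ α G → λG G ≤ℤ ∂ (R G)
    from-independent I I-independent ∣I∣≡α = begin
      λG G
        ≡⟨ [+a]-[+b]+[+c]≡[+a+c]-[+b] m n (2 * α G) ⟩
      ℤ.+ (m + 2 * α G) ℤ.- ℤ.+ n
        ≤⟨ [+a]-[+b]≤[+c]-[+d] (m + 2 * α G) n (∣ B (R G) (complement I) ∣) (∣ complement I ∣)
                               (counting I I-independent ∣I∣≡α) ⟩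
      ∂S (R G) (complement I)
        ≤⟨ ∂S≤∂ (R G) (complement I) ⟩
      ∂ (R G) ∎
      where open ℤ.≤-Reasoning

  ∂≤λG+[n-μ]/2 : ∂ (R G) ≤ℤ λG G ℤ.+ ℤ.+ ((n ∸ μ G) / 2)
  ∂≤λG+[n-μ]/2 = let D , no-edges , ∂D≡∂ , μ≤∣D∣ = μ-attained in from-witness D no-edges ∂D≡∂ μ≤∣D∣
    where
    q = (n ∸ μ G) / 2
    counting-ℕ : ∀ D → (∀ e → ¬ T (inE D e)) → μ G ≤ ∣ D ∣ → ∣ B (R G) D ∣ + n ≤ m + 2 * α G + q + ∣ D ∣
    counting-ℕ D no-edges μ≤∣D∣ = begin
        b + n                        ≡⟨ cong (b +_) (trans (sym (count+count-not (inV D))) (+-comm s t)) ⟩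
        b + (t + s)                  ≡⟨ +-assoc b t s ⟨
        b + t + s                    ≤⟨ +-monoˡ-≤ s (cancel b e t m (2 * α G) (t / 2) (∣B∣+inducedEdges≤ D)
                                                        (2*count≤2*α+inducedEdges+count/2 (not ∘ inV D))) ⟩
        m + 2 * α G + t / 2 + s      ≤⟨ +-mono-≤ (+-monoʳ-≤ (m + 2 * α G) t/2≤q) (≤-reflexive (sym ∣D∣≡s)) ⟩
        m + 2 * α G + q + ∣ D ∣      ∎
      where
      open ≤-Reasoning
      s = count (inV D)
      t = count (not ∘ inV D)
      e = inducedEdges (not ∘ inV D)
      b = ∣ B (R G) D ∣
      ∣D∣≡s : ∣ D ∣ ≡ s
      ∣D∣≡s = trans (∣S∣≡∣S∩V∣+∣S∩E∣ D)
                    (trans (cong (s +_) (trans (sum-cong-≗ (𝟙-false ∘ no-edges)) (sum-replicate-zero m))) (+-identityʳ s))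
      t/2≤q : t / 2 ≤ q
      t/2≤q = /-monoˡ-≤ 2 (≤-trans (≤-reflexive (trans (sym (m+n∸m≡n s t)) (cong (_∸ s) (count+count-not (inV D)))))
                                   (∸-monoʳ-≤ n (≤-trans μ≤∣D∣ (≤-reflexive ∣D∣≡s))))
      cancel : ∀ b e t m a h → b + e ≤ t + m → 2 * t ≤ a + e + h → b + t ≤ m + a + h
      cancel b e t m a h b+e≤t+m 2t≤a+e+h = +-cancelʳ-≤ (e + t) (b + t) (m + a + h)
        (≤-trans (≤-reflexive (lhs b t e)) (≤-trans (+-mono-≤ b+e≤t+m 2t≤a+e+h) (≤-reflexive (rhs t m a e h))))
        where
        lhs : ∀ b t e → b + t + (e + t) ≡ (b + e) + 2 * t
        lhs = solve-∀
        rhs : ∀ t m a e h → (t + m) + (a + e + h) ≡ (m + a + h) + (e + t)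
        rhs = solve-∀
    from-witness : ∀ D → (∀ e → ¬ T (inE D e)) → ∂S (R G) D ≡ ∂ (R G) → μ G ≤ ∣ D ∣ →
                   ∂ (R G) ≤ℤ λG G ℤ.+ ℤ.+ q
    from-witness D no-edges ∂D≡∂ μ≤∣D∣ = begin
      ∂ (R G)                              ≡⟨ ∂D≡∂ ⟨
      ∂S (R G) D                           ≤⟨ [+a]-[+b]≤[+c]-[+d] (∣ B (R G) D ∣) (∣ D ∣) (m + 2 * α G + q) n counting ⟩
      ℤ.+ (m + 2 * α G + q) ℤ.- ℤ.+ n      ≡⟨ [+a]-[+b]+[+c]≡[+a+c]-[+b] (m + 2 * α G) n q ⟨
      ℤ.+ (m + 2 * α G) ℤ.- ℤ.+ n ℤ.+ ℤ.+ q ≡⟨ cong (ℤ._+ ℤ.+ q) ([+a]-[+b]+[+c]≡[+a+c]-[+b] m n (2 * α G)) ⟨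
      λG G ℤ.+ ℤ.+ q                       ∎
      where
      open ℤ.≤-Reasoning
      counting : ∣ B (R G) D ∣ + n ≤ m + 2 * α G + q + ∣ D ∣
      counting = counting-ℕ D no-edges μ≤∣D∣

theorem3p3 : (G : Graph) → Connected G → 3 ≤ order G →
    (λG G ≤ℤ ∂ (R G)) × (∂ (R G) ≤ℤ λG G ℤ.+ ℤ.+ ((order G ∸ μ G) / 2))
theorem3p3 G conn 3≤n = λG≤∂ G conn 3≤n , ∂≤λG+[n-μ]/2 G
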